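{- Let $\Sigma$ be a signature and $E$ an equational theory inducing a convergent, subterm convergent rewrite system, with the proof system $K$ as described in the context. For every finite collection $\Gamma$ of knowledge formulas and knowledge formulas $A$, $C$: if $\Gamma \vdash A$ and $\Gamma, A \vdash C$ are derivable in $K$, then $\Gamma \vdash C$ is derivable in $K$.
   Context: Terms are built from an infinite set of names and an infinite set of variables by applying function symbols $f \in \Sigma$ (each with a fixed arity). An equational theory $E$ is a set of equations $t = s$; it is assumed that orienting each equation as $t \rightarrow s$ gives a convergent rewrite system that is subterm convergent (in every rule the right-hand side is a proper subterm of the left-hand side). The outermost function symbol of the left-hand side of a rewrite rule is a destructor; all other function symbols are constructors. Knowledge formulas are $\phi,\psi ::= \phi \wedge \psi \mid t \mid \top$ ($t$ a term). The sequent calculus $K$ has sequents $\Gamma \vdash C$ with $\Gamma$ a finite collection of knowledge formulas and $C$ a knowledge formula, and rules: (Id) $\Gamma, A \vdash A$; ($\wedge$-left) from $\Gamma, A, B \vdash C$ infer $\Gamma, A\wedge B \vdash C$; ($\wedge$-right) from $\Gamma \vdash A$ and $\Gamma \vdash B$ infer $\Gamma \vdash A \wedge B$; for every constructor $f$ of arity $n$: (funRight) from $\Gamma \vdash t_1, \dots, \Gamma \vdash t_n$ infer $\Gamma \vdash f(t_1,\dots,t_n)$, and (AttLeft) from $\Gamma, f(t_1,\dots,t_n) \vdash C$ infer $\Gamma, t_1,\dots,t_n \vdash C$; for every equation $f(t_1,\dots,t_n) = s$ in $E$: (DestrLeft) from $\Gamma, s \vdash C$ infer $\Gamma, f(t_1,\dots,t_n)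 \vdash C$. -}

module Defs where

open import Data.Nat using (ℕ)
open import Data.Fin using (Fin)
open import Data.Vec using (Vec; []; _∷_; lookup; _[_]≔_; toList)
open import Data.List using (List; []; _∷_; _++_)
open import Data.List.Membership.Propositional using (_∈_)
open import Data.List.Relation.Binary.Permutation.Propositional using (_↭_)
open import Data.Product using (Σ; _×_; _,_; ∃)
open import Relation.Nullary using (¬_)
open import Relation.Binary.Construct.Closure.ReflexiveTransitive using (Star)
open import Induction.WellFounded using (WellFounded)

record Signature : Set₁ where
  field
    Sym   : Set
    arity : Sym → ℕ
open Signature public

module _ (S : Signature) where

  data Term : Set where
    name : ℕ → Term
    var  : ℕ → Term
    app  : (f : Sym S) → Vec Term (arity S f) → Term

  Subst : Set
  Subst = ℕ → Term

  mutual
    subst : Subst → Term → Term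
    subst σ (name a)   = name a
    subst σ (var x)    = σ x
    subst σ (app f ts) = app f (substVec σ ts)

    substVec : ∀ {n} → Subst → Vec Term n → Vec Term n
    substVec σ []       = []
    substVec σ (t ∷ ts) = subst σ t ∷ substVec σ ts

  -- An equation t = s, oriented as the rewrite rule t → s.
  Equation : Set
  Equation = Term × Term

  data _⊏_ : Term → Term → Set where
    here  : ∀ f (ts : Vec Term (arity S f)) (i : Fin (arity S f)) →
            lookup ts i ⊏ app f ts
    there : ∀ f (ts : Vec Term (arity S f)) (i : Fin (arity S f)) {s} →
            s ⊏ lookup ts i → s ⊏ app f ts

module _ {S : Signature} (E : List (Equation S)) where

  data _⟶_ : Term S → Term S → Set where
    root : ∀ {l r} → (l , r) ∈ E → (σ : Subst S) → subst S σ l ⟶ subst S σ r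
    ctx  : ∀ f (ts : Vec (Term S) (arity S f)) (i : Fin (arity S f)) {t'} →
           lookup ts i ⟶ t' → app f ts ⟶ app f (ts [ i ]≔ t')

  _⟶*_ : Term S → Term S → Set
  _⟶*_ = Star _⟶_

  Terminating : Set
  Terminating = WellFounded (λ u t → t ⟶ u)

  Confluent : Set
  Confluent = ∀ {t u v} → t ⟶* u → t ⟶* v → Σ (Term S) λ w → (u ⟶* w) × (v ⟶* w)

  Convergent : Set
  Convergent = Terminating × Confluent

  SubtermConvergent : Set
  SubtermConvergent = ∀ {l r} → (l , r) ∈ E → _⊏_ S r l

  IsDestructor : Sym S → Set
  IsDestructor f = Σ (Vec (Term S) (arity S f)) λ ts → ∃ λ r → (app f ts , r) ∈ E

  IsConstructor : Sym S → Set
  IsConstructor f = ¬ IsDestructor f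

  data Formula : Set where
    _∧_ : Formula → Formula → Formula
    trm : Term S → Formula
    ⊤   : Formula

  Ctx : Set
  Ctx = List Formula

  -- The sequent calculus K.  Contexts are finite collections (multisets),
  -- represented as lists together with an exchange rule.
  data _⊢_ : Ctx → Formula → Set where
    exch      : ∀ {Γ Δ C} → Γ ↭ Δ → Γ ⊢ C → Δ ⊢ C
    Id        : ∀ {Γ A} → (A ∷ Γ) ⊢ A
    ∧-left    : ∀ {Γ A B C} → (A ∷ B ∷ Γ) ⊢ C → ((A ∧ B) ∷ Γ) ⊢ C
    ∧-right   : ∀ {Γ A B} → Γ ⊢ A → Γ ⊢ B → Γ ⊢ (A ∧ B)
    funRight  : ∀ {Γ} f → IsConstructor f → (ts : Vec (Term S) (arity S f)) →
                (∀ i → Γ ⊢ trm (lookup ts i)) → Γ ⊢ trm (app f ts)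
    AttLeft   : ∀ {Γ C} f → IsConstructor f → (ts : Vec (Term S) (arity S f)) →
                (trm (app f ts) ∷ Γ) ⊢ C →
                (Data.List.map trm (toList ts) ++ Γ) ⊢ C
    DestrLeft : ∀ {Γ C l r} → (l , r) ∈ E → (σ : Subst S) →
                (trm (subst S σ r) ∷ Γ) ⊢ C → (trm (subst S σ l) ∷ Γ) ⊢ C

module Submission where

-- The proof is semantic: we describe directly which formulas are derivable.
-- Call C a left decomposition of a hypothesis A (A ↠ C) if C arises from A by
-- projecting conjunctions and rewriting a rule instance at the root, i.e. by
-- the left rules ∧-left and DestrLeft.  A formula is *analytic* over Γ if it is
-- built by ∧-right and funRight from left decompositions of hypotheses in Γ.
--   * Completeness: analytic formulas are derivable (read the definition as
--     a recipe for a derivation).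
--   * Soundness: derivable sequents are analytic, by induction on derivations;
--     every left rule only changes the context in a way analytic formulas
--     survive (analytic-rebase).
--   * Cut for analytic formulas is immediate, because analytic formulas are
--     closed under left decomposition (analytic-↠).  The only subtle point is
--     that a constructor-headed term can never be the root of a rule instance;
--     this needs every left-hand side to be an application, which is exactly
--     what subterm convergence gives.

open import Defs
open import Data.List using (List; _∷_; _++_; map)
open import Data.Vec using (Vec; lookup; toList)
open import Data.Product using (_,_)
open import Data.List.Membership.Propositional using (_∈_)
open import Data.List.Membership.Propositional.Properties using (∈-∃++; ∈-map⁺)
open import Data.List.Relation.Unary.Any using (here; there)
open import Data.List.Relation.Unary.Any.Properties using (++⁺ˡ; ++⁺ʳ)
open import Data.Vec.Membership.Propositional.Properties using (∈-lookup; ∈-toList⁺)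
open import Data.List.Relation.Binary.Permutation.Propositional using (swap; ↭-refl; ↭-sym)
open import Data.List.Relation.Binary.Permutation.Propositional.Properties using (∈-resp-↭; shift)
open import Relation.Binary.PropositionalEquality using (_≡_; _≢_; refl)

data IsApp {S : Signature} : Term S → Set where
  app : ∀ f (ts : Vec (Term S) (arity S f)) → IsApp (app f ts)

-- Anything with a proper subterm is an application; hence in a subterm
-- convergent theory no left-hand side is a name or a variable.
⊏-target-isApp : ∀ {S : Signature} {s t : Term S} → _⊏_ S s t → IsApp t
⊏-target-isApp (here f ts _)    = app f ts
⊏-target-isApp (there f ts _ _) = app f ts

module CutAdmissibility
  (S : Signature) (E : List (Equation S))
  (lhs-isApp : ∀ {l r} → (l , r) ∈ E → IsApp l) where

  Form : Set
  Form = Formula E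

  _⊢K_ : Ctx E → Form → Set
  _⊢K_ = _⊢_ E

  data _↠_ : Form → Form → Set where
    stop  : ∀ {A} → A ↠ A
    fst   : ∀ {A B C} → A ↠ C → (A ∧ B) ↠ C
    snd   : ∀ {A B C} → B ↠ C → (A ∧ B) ↠ C
    destr : ∀ {l r C} → (l , r) ∈ E → (σ : Subst S) →
            trm (subst S σ r) ↠ C → trm (subst S σ l) ↠ C

  ↠-trans : ∀ {A B C} → A ↠ B → B ↠ C → A ↠ C
  ↠-trans stop          q = q
  ↠-trans (fst p)       q = fst (↠-trans p q)
  ↠-trans (snd p)       q = snd (↠-trans p q)
  ↠-trans (destr m σ p) q = destr m σ (↠-trans p q)

  constructor-not-redex : ∀ {l r f} {ts : Vec (Term S) (arity S f)} →
    IsConstructor E f → (l , r) ∈ E → (σ : Subst S) → subst S σ l ≢ app f ts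
  constructor-not-redex c m σ eq with lhs-isApp m
  constructor-not-redex {r = r} c m σ refl | app f us = c (us , r , m)

  trm-injective : ∀ {t u : Term S} → _≡_ {A = Form} (trm t) (trm u) → t ≡ u
  trm-injective refl = refl

  constructor-↠ : ∀ {A D f} {ts : Vec (Term S) (arity S f)} → IsConstructor E f →
                  A ↠ D → A ≡ trm (app f ts) → D ≡ trm (app f ts)
  constructor-↠ c stop          eq = eq
  constructor-↠ c (destr m σ p) eq with () ← constructor-not-redex c m σ (trm-injective eq)

  data Analytic (Γ : Ctx E) : Form → Set where
    hyp  : ∀ {D C} → D ∈ Γ → D ↠ C → Analytic Γ C
    conj : ∀ {A B} → Analytic Γ A → Analytic Γ B → Analytic Γ (A ∧ B)
    fun  : ∀ f → IsConstructor E f → (ts : Vec (Term S) (arity S f)) →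
           (∀ i → Analytic Γ (trm (lookup ts i))) → Analytic Γ (trm (app f ts))

  assumption : ∀ {Γ D} → D ∈ Γ → Analytic Γ D
  assumption x = hyp x stop

  analytic-↠ : ∀ {Γ A D} → Analytic Γ A → A ↠ D → Analytic Γ D
  analytic-↠ (hyp x p)  q       = hyp x (↠-trans p q)
  analytic-↠ (conj a b) stop    = conj a b
  analytic-↠ (conj a b) (fst q) = analytic-↠ a q
  analytic-↠ (conj a b) (snd q) = analytic-↠ b q
  analytic-↠ (fun f c ts k) q with refl ← constructor-↠ c q refl = fun f c ts k

  _⇛_ : Ctx E → Ctx E → Set
  Γ ⇛ Δ = ∀ {D} → D ∈ Γ → Analytic Δ D

  analytic-rebase : ∀ {Γ Δ C} → Γ ⇛ Δ → Analytic Γ C → Analytic Δ C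
  analytic-rebase h (hyp x p)      = analytic-↠ (h x) p
  analytic-rebase h (conj a b)     = conj (analytic-rebase h a) (analytic-rebase h b)
  analytic-rebase h (fun f c ts k) = fun f c ts (λ i → analytic-rebase h (k i))

  analytic-cut : ∀ {Γ A C} → Analytic Γ A → Analytic (A ∷ Γ) C → Analytic Γ C
  analytic-cut a = analytic-rebase λ { (here refl) → a ; (there x) → assumption x }

  ∧-left-⇛ : ∀ {Γ A B} → (A ∷ B ∷ Γ) ⇛ ((A ∧ B) ∷ Γ)
  ∧-left-⇛ (here refl)         = hyp (here refl) (fst stop)
  ∧-left-⇛ (there (here refl)) = hyp (here refl) (snd stop)
  ∧-left-⇛ (there (there x))   = assumption (there x)

  AttLeft-⇛ : ∀ {Γ} f → IsConstructor E f → (ts : Vec (Term S) (arity S f)) →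
              (trm (app f ts) ∷ Γ) ⇛ (map trm (toList ts) ++ Γ)
  AttLeft-⇛ f c ts (here refl) =
    fun f c ts (λ i → assumption (++⁺ˡ (∈-map⁺ trm (∈-toList⁺ (∈-lookup i ts)))))
  AttLeft-⇛ f c ts (there x) = assumption (++⁺ʳ (map trm (toList ts)) x)

  DestrLeft-⇛ : ∀ {Γ l r} → (l , r) ∈ E → (σ : Subst S) →
                (trm (subst S σ r) ∷ Γ) ⇛ (trm (subst S σ l) ∷ Γ)
  DestrLeft-⇛ m σ (here refl) = hyp (here refl) (destr m σ stop)
  DestrLeft-⇛ m σ (there x)   = assumption (there x)

  sound : ∀ {Γ C} → Γ ⊢K C → Analytic Γ C
  sound (exch p d)          = analytic-rebase (λ x → assumption (∈-resp-↭ p x)) (sound d)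
  sound Id                  = assumption (here refl)
  sound (∧-left d)          = analytic-rebase ∧-left-⇛ (sound d)
  sound (∧-right a b)       = conj (sound a) (sound b)
  sound (funRight f c ts k) = fun f c ts (λ i → sound (k i))
  sound (AttLeft f c ts d)  = analytic-rebase (AttLeft-⇛ f c ts) (sound d)
  sound (DestrLeft m σ d)   = analytic-rebase (DestrLeft-⇛ m σ) (sound d)

  ↠-derivable : ∀ {Γ A C} → A ↠ C → (A ∷ Γ) ⊢K C
  ↠-derivable stop          = Id
  ↠-derivable (fst p)       = ∧-left (↠-derivable p)
  ↠-derivable (snd p)       = ∧-left (exch (swap _ _ ↭-refl) (↠-derivable p))
  ↠-derivable (destr m σ p) = DestrLeft m σ (↠-derivable p)

  complete : ∀ {Γ C} → Analytic Γ C → Γ ⊢K C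
  complete (hyp x p) with ys , zs , refl ← ∈-∃++ x =
    exch (↭-sym (shift _ ys zs)) (↠-derivable p)
  complete (conj a b)     = ∧-right (complete a) (complete b)
  complete (fun f c ts k) = funRight f c ts (λ i → complete (k i))

mainTheorem5 : (S : Signature) (E : List (Equation S)) →
    Convergent E → SubtermConvergent E →
    (Γ : Ctx E) (A C : Formula E) →
    _⊢_ E Γ A → _⊢_ E (A ∷ Γ) C → _⊢_ E Γ C
mainTheorem5 S E _ subterm Γ A C ⊢A A⊢C =
  complete (analytic-cut (sound ⊢A) (sound A⊢C))
  where open CutAdmissibility S E (λ m → ⊏-target-isApp (subterm m))
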